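{- Suppose there exist a $\mathsf{PHHF}(2;\kappa_2,(v_{1,2},v_{2,2}),2)$, a $\mathsf{PHHF}(2;\kappa_3,(v_{1,3},v_{2,3}),2)$, and a fractal $\mathsf{PHHF}(3;\kappa_1,(v_{1,1},v_{2,1},v_{3,1}),3)$. Then a $\mathsf{PHHF}(5;2\kappa_1+2\kappa_2+\kappa_3,(w_0,\dots,w_4),7)$ exists, where $w_0=\kappa_1+2\kappa_2+v_{1,1}+v_{1,3}$, $w_1=\kappa_1+2\kappa_2+v_{1,1}+v_{2,3}$, $w_2=2\kappa_1+\kappa_3+v_{1,2}+v_{2,2}$, $w_3=\kappa_2+\kappa_3+v_{2,1}+v_{3,1}+v_{2,2}$, $w_4=\kappa_2+\kappa_3+v_{1,2}+v_{2,1}+v_{3,1}$.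
   Context: An $\mathsf{HHF}(N;k,(w_1,\dots,w_N))$ is an $N\times k$ array in which row $i$ contains at most $w_i$ distinct symbols. Given a set $S$ of columns and a partition of $S$ into $p$ classes (some possibly empty), a row $r$ separates it if any two columns in distinct classes have distinct entries in row $r$. A $\mathsf{DHHF}(N;k,(w_1,\dots,w_N),t,p)$ is an $\mathsf{HHF}(N;k,(w_1,\dots,w_N))$ in which every partition of every $t$-set of columns into $p$ classes is separated by some row. A $\mathsf{PHHF}(N;k,(w_1,\dots,w_N),t)$ is a $\mathsf{DHHF}(N;k,(w_1,\dots,w_N),t,t)$. A $\mathsf{DHHF}(t;k,(v_1,\dots,v_t),t,p)$ is fractal if $t\le 2$, or if for each row $j$, deleting row $j$ yields a fractal $\mathsf{DHHF}(t-1;k,(v_1,\dots,v_{j-1},v_{j+1},\dots,v_t),t-1,\min(p,t-1))$; a fractal $\mathsf{PHHF}$ is a fractal $\mathsf{DHHF}$ with $p=t$. -}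

module Defs where

open import Data.Nat using (ℕ; zero; suc; _⊓_)
open import Data.Fin using (Fin; punchIn)
open import Data.Product using (Σ; ∃-syntax; _×_)
open import Data.Unit using (⊤)
open import Relation.Binary.PropositionalEquality using (_≡_; _≢_)
open import Function.Definitions using (Injective)

HHF : (N k : ℕ) → (Fin N → ℕ) → Set
HHF N k w = (i : Fin N) → Fin k → Fin (w i)

-- Row r separates the partition of the column tuple s (a t-set of columns,
-- listed injectively) into p classes given by the class map c
-- (classes may be empty): columns in distinct classes get distinct entries.
Separates : {N k : ℕ} {w : Fin N → ℕ} → HHF N k w → Fin N →
            {t p : ℕ} → (Fin t → Fin k) → (Fin t → Fin p) → Set
Separates A r s c = ∀ a b → c a ≢ c b → A r (s a) ≢ A r (s b)

IsDHHF : (N k : ℕ) (w : Fin N → ℕ) (t p : ℕ) → HHF N k w → Set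
IsDHHF N k w t p A =
  (s : Fin t → Fin k) → Injective _≡_ _≡_ s →
  (c : Fin t → Fin p) → ∃[ r ] Separates A r s c

IsPHHF : (N k : ℕ) (w : Fin N → ℕ) (t : ℕ) → HHF N k w → Set
IsPHHF N k w t A = IsDHHF N k w t t A

PHHF : (N k : ℕ) (w : Fin N → ℕ) (t : ℕ) → Set
PHHF N k w t = Σ (HHF N k w) (IsPHHF N k w t)

deleteRow : {N k : ℕ} {w : Fin (suc N) → ℕ} → (j : Fin (suc N)) →
            HHF (suc N) k w → HHF N k (λ i → w (punchIn j i))
deleteRow j A i = A (punchIn j i)

IsFractalDHHF : (t k : ℕ) (v : Fin t → ℕ) (p : ℕ) → HHF t k v → Set
IsFractalDHHF zero k v p A = IsDHHF zero k v zero p A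
IsFractalDHHF (suc zero) k v p A = IsDHHF (suc zero) k v (suc zero) p A
IsFractalDHHF (suc (suc zero)) k v p A = IsDHHF 2 k v 2 p A
IsFractalDHHF (suc (suc (suc t))) k v p A =
  IsDHHF (suc (suc (suc t))) k v (suc (suc (suc t))) p A ×
  ((j : Fin (suc (suc (suc t)))) →
     IsFractalDHHF (suc (suc t)) k (λ i → v (punchIn j i))
                   (p ⊓ suc (suc t)) (deleteRow j A))

IsFractalPHHF : (t k : ℕ) (v : Fin t → ℕ) → HHF t k v → Set
IsFractalPHHF t k v A = IsFractalDHHF t k v t A

FractalPHHF : (t k : ℕ) (v : Fin t → ℕ) → Set
FractalPHHF t k v = Σ (HHF t k v) (IsFractalPHHF t k v)

-- The columns of the new array form five blocks A₁ A₂ B₁ B₂ C: two copies of the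
-- columns of the fractal PHHF F, two of those of P₂ and one of those of P₃. In each
-- row, every block either receives fresh symbols, one per column, or copies a row of
-- its component, and different blocks of a row use disjoint alphabets. If some seven
-- columns are separated by no row, every row has a collision inside a block it copies
-- into. A block in which m ≥ 1 rows collide contains at least m + 1 of the seven
-- columns: its rows copy distinct rows of the component, and a perfect array (for F
-- also each pair of its rows, by fractality) separates any set of columns as large as
-- its number of rows. Hence the seven columns number at least 5 + (number of blocks
-- met by a collision) ≥ 8, because no two blocks between them meet all five rows.
module Submission where

open import Defs
open import Data.Nat using (ℕ; _+_; _*_)
open import Data.Fin using (Fin; zero; suc)

module _ where

  open import Data.Bool using (Bool; true; false; T)
  open import Data.Bool.Properties using (T?)
  open import Data.Empty using (⊥; ⊥-elim)
  open import Data.Fin using (splitAt; join; cast; _≟_)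
  open import Data.Fin.Patterns using (0F; 1F; 2F; 3F; 4F)
  open import Data.Fin.Properties using (splitAt-join; join-splitAt; cast-involutive; all?; ¬∀⟶∃¬)
  open import Data.List using (List; []; _∷_; length; lookup; tabulate)
  open import Data.List.Properties using (length-tabulate)
  open import Data.List.Membership.Propositional using (_∈_; find; lose)
  open import Data.List.Membership.Propositional.Properties using (∈-lookup; ∈-tabulate⁺)
  open import Data.List.Relation.Unary.All as All using (All; []; _∷_)
  open import Data.List.Relation.Unary.Any using (Any; here; index; any?)
  open import Data.List.Relation.Unary.Any.Properties using (lookup-index)
  open import Data.List.Relation.Unary.Unique.Propositional using (Unique; []; _∷_)
  open import Data.List.Relation.Unary.Unique.Propositional.Properties using (tabulate⁺)
  import Data.Nat as ℕ
  open import Data.Nat using (_≤_; z≤n; s≤s; _≤?_)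
  open import Data.Nat.Properties
    using (≤∧≢⇒<; +-suc; +-identityʳ; +-mono-≤; <-irrefl; module ≤-Reasoning)
  open import Data.Nat.Tactic.RingSolver using (solve-∀)
  open import Data.Product using (Σ; ∃-syntax; _×_; _,_; proj₁; proj₂)
  import Data.Product as Product
  open import Data.Sum using (_⊎_; inj₁; inj₂)
  import Data.Sum as Sum
  import Data.Sum.Properties as Sum
  import Data.Vec.Functional as Vector
  open import Function using (id; _∘_)
  open import Function.Definitions using (Injective)
  open import Relation.Nullary using (Dec; yes; no; ¬_)
  open import Relation.Nullary.Decidable
    using (map′; ¬?; _×-dec_; True; isYes; toWitness; _→-dec_)
  open import Relation.Binary.PropositionalEquality

  private variable
    N k v t : ℕ
    B : Set
    w : Fin N → ℕ

  Collision : (Fin k → B) → List (Fin k) → Set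
  Collision f xs = ∃[ i ] ∃[ j ] i ∈ xs × j ∈ xs × i ≢ j × f i ≡ f j

  collision? : (f : Fin k → Fin v) (xs : List (Fin k)) → Dec (Collision f xs)
  collision? f xs =
    map′ fromAny toAny (any? (λ i → any? (λ j → ¬? (i ≟ j) ×-dec (f i ≟ f j)) xs) xs)
    where
    fromAny : Any (λ i → Any (λ j → i ≢ j × f i ≡ f j) xs) xs → Collision f xs
    fromAny a with i , i∈ , b ← find a with j , j∈ , i≢j , e ← find b = i , j , i∈ , j∈ , i≢j , e
    toAny : Collision f xs → Any (λ i → Any (λ j → i ≢ j × f i ≡ f j) xs) xs
    toAny (i , j , i∈ , j∈ , i≢j , e) = lose i∈ (lose j∈ (i≢j , e))

  collision⇒2≤length : {f : Fin k → B} {xs : List (Fin k)} → Collision f xs → 2 ≤ length xs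
  collision⇒2≤length {xs = _ ∷ _ ∷ _} _ = s≤s (s≤s z≤n)
  collision⇒2≤length {xs = _ ∷ []} (_ , _ , here refl , here refl , i≢j , _) = ⊥-elim (i≢j refl)

  collision-∘ : {C : Set} {g : B → C} {f : Fin k → B} {xs : List (Fin k)} →
    Injective _≡_ _≡_ g → Collision (g ∘ f) xs → Collision f xs
  collision-∘ g-injective (i , j , i∈ , j∈ , i≢j , e) = i , j , i∈ , j∈ , i≢j , g-injective e

  Unique⇒lookup-injective : {xs : List (Fin k)} → Unique xs → Injective _≡_ _≡_ (lookup xs)
  Unique⇒lookup-injective (_ ∷ _) {zero} {zero} _ = refl
  Unique⇒lookup-injective (x∉ ∷ _) {zero} {suc j} e = ⊥-elim (All.lookup x∉ (∈-lookup j) e)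
  Unique⇒lookup-injective (x∉ ∷ _) {suc i} {zero} e = ⊥-elim (All.lookup x∉ (∈-lookup i) (sym e))
  Unique⇒lookup-injective (_ ∷ u) {suc i} {suc j} e = cong suc (Unique⇒lookup-injective u e)

  perfect⇒collision-free-row : (A : HHF N k w) {xs : List (Fin k)} →
    IsPHHF N k w (length xs) A → Unique xs → ∃[ r ] ¬ Collision (A r) xs
  perfect⇒collision-free-row A {xs} perfect u
    with r , separated ← perfect (lookup xs) (Unique⇒lookup-injective u) id
    = r , λ (i , j , i∈ , j∈ , i≢j , e) →
        separated (index i∈) (index j∈)
          (λ same → i≢j (trans (lookup-index i∈)
                              (trans (cong (lookup xs) same) (sym (lookup-index j∈)))))
          (subst₂ (λ x y → A r x ≡ A r y) (lookup-index i∈) (lookup-index j∈) e)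

  all-rows-collide⇒length≢ : (A : HHF N k w) {xs : List (Fin k)} →
    IsPHHF N k w t A → Unique xs → (∀ r → Collision (A r) xs) → length xs ≢ t
  all-rows-collide⇒length≢ A perfect u collide refl
    with r , free ← perfect⇒collision-free-row A perfect u = free (collide r)

  collision-free⇒separates : (A : HHF N k w) {r : Fin N} {s : Fin t → Fin k} {p : ℕ}
    {c : Fin t → Fin p} → Injective _≡_ _≡_ s → ¬ Collision (A r) (tabulate s) →
    Separates A r s c
  collision-free⇒separates A {s = s} {c = c} s-injective free a b ca≢cb e =
    free (s a , s b , ∈-tabulate⁺ a , ∈-tabulate⁺ b ,
          (λ sa≡sb → ca≢cb (cong c (s-injective sa≡sb))) , e)

  two-rows-collide⇒3≤length : (M : HHF 2 k w) {xs : List (Fin k)} →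
    IsPHHF 2 k w 2 M → Unique xs → Collision (M 0F) xs → Collision (M 1F) xs →
    3 ≤ length xs
  two-rows-collide⇒3≤length M perfect u c₀ c₁ =
    ≤∧≢⇒< (collision⇒2≤length c₀)
          (≢-sym (all-rows-collide⇒length≢ M perfect u λ { 0F → c₀ ; 1F → c₁ }))

  three-rows-collide⇒4≤length : (F : HHF 3 k w) {xs : List (Fin k)} →
    IsFractalPHHF 3 k w F → Unique xs →
    Collision (F 0F) xs → Collision (F 1F) xs → Collision (F 2F) xs → 4 ≤ length xs
  three-rows-collide⇒4≤length F (perfect , pairs) u c₀ c₁ c₂ =
    ≤∧≢⇒< (two-rows-collide⇒3≤length (deleteRow 0F F) (pairs 0F) u c₁ c₂)
          (≢-sym (all-rows-collide⇒length≢ F perfect u λ { 0F → c₀ ; 1F → c₁ ; 2F → c₂ }))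

  columnsNeeded : ℕ → ℕ
  columnsNeeded 0 = 0
  columnsNeeded (ℕ.suc m) = 2 + m

  bit : Bool → ℕ
  bit true = 1
  bit false = 0

  perfect₂-bound : (M : HHF 2 k w) {xs : List (Fin k)} → IsPHHF 2 k w 2 M → Unique xs →
    (b₀ b₁ : Bool) → (T b₀ → Collision (M 0F) xs) → (T b₁ → Collision (M 1F) xs) →
    columnsNeeded (bit b₀ + bit b₁) ≤ length xs
  perfect₂-bound _ _ _ false false _ _ = z≤n
  perfect₂-bound _ _ _ true false c₀ _ = collision⇒2≤length (c₀ _)
  perfect₂-bound _ _ _ false true _ c₁ = collision⇒2≤length (c₁ _)
  perfect₂-bound M perfect u true true c₀ c₁ = two-rows-collide⇒3≤length M perfect u (c₀ _) (c₁ _)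

  fractal₃-bound : (F : HHF 3 k w) {xs : List (Fin k)} → IsFractalPHHF 3 k w F → Unique xs →
    (b₀ b₁ b₂ : Bool) → (T b₀ → Collision (F 0F) xs) → (T b₁ → Collision (F 1F) xs) →
    (T b₂ → Collision (F 2F) xs) → columnsNeeded (bit b₀ + bit b₁ + bit b₂) ≤ length xs
  fractal₃-bound _ _ _ false false false _ _ _ = z≤n
  fractal₃-bound _ _ _ true false false c₀ _ _ = collision⇒2≤length (c₀ _)
  fractal₃-bound _ _ _ false true false _ c₁ _ = collision⇒2≤length (c₁ _)
  fractal₃-bound _ _ _ false false true _ _ c₂ = collision⇒2≤length (c₂ _)
  fractal₃-bound F (_ , pairs) u true true false c₀ c₁ _ =
    two-rows-collide⇒3≤length (deleteRow 2F F) (pairs 2F) u (c₀ _) (c₁ _)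
  fractal₃-bound F (_ , pairs) u true false true c₀ _ c₂ =
    two-rows-collide⇒3≤length (deleteRow 1F F) (pairs 1F) u (c₀ _) (c₂ _)
  fractal₃-bound F (_ , pairs) u false true true _ c₁ c₂ =
    two-rows-collide⇒3≤length (deleteRow 0F F) (pairs 0F) u (c₁ _) (c₂ _)
  fractal₃-bound F fractal u true true true c₀ c₁ c₂ =
    three-rows-collide⇒4≤length F fractal u (c₀ _) (c₁ _) (c₂ _)

  module _ {A L R : Set} (p : A → L ⊎ R) where

    lefts : List A → List L
    lefts [] = []
    lefts (x ∷ xs) with p x
    ... | inj₁ y = y ∷ lefts xs
    ... | inj₂ _ = lefts xs

    rights : List A → List R
    rights [] = []
    rights (x ∷ xs) with p x
    ... | inj₁ _ = rights xs
    ... | inj₂ z = z ∷ rights xs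

    length-lefts+rights : ∀ xs → length (lefts xs) + length (rights xs) ≡ length xs
    length-lefts+rights [] = refl
    length-lefts+rights (x ∷ xs) with p x
    ... | inj₁ _ = cong ℕ.suc (length-lefts+rights xs)
    ... | inj₂ _ = trans (+-suc (length (lefts xs)) _) (cong ℕ.suc (length-lefts+rights xs))

    ∈-lefts : ∀ {x y xs} → x ∈ xs → p x ≡ inj₁ y → y ∈ lefts xs
    ∈-lefts {xs = x ∷ _} (here refl) px rewrite px = here refl
    ∈-lefts {xs = x′ ∷ _} (Any.there x∈) px with p x′
    ... | inj₁ _ = Any.there (∈-lefts x∈ px)
    ... | inj₂ _ = ∈-lefts x∈ px

    ∈-rights : ∀ {x z xs} → x ∈ xs → p x ≡ inj₂ z → z ∈ rights xs
    ∈-rights {xs = x ∷ _} (here refl) px rewrite px = here refl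
    ∈-rights {xs = x′ ∷ _} (Any.there x∈) px with p x′
    ... | inj₁ _ = ∈-rights x∈ px
    ... | inj₂ _ = Any.there (∈-rights x∈ px)

    module _ (p-injective : Injective _≡_ _≡_ p) where

      lefts-unique : ∀ {xs} → Unique xs → Unique (lefts xs)
      lefts-unique [] = []
      lefts-unique {x ∷ _} (x∉ ∷ u) with p x in px
      ... | inj₁ y = y∉ x∉ ∷ lefts-unique u
        where
        y∉ : ∀ {ys} → All (x ≢_) ys → All (y ≢_) (lefts ys)
        y∉ [] = []
        y∉ {x′ ∷ _} (x≢x′ ∷ x∉) with p x′ in px′
        ... | inj₁ _ = (λ { refl → x≢x′ (p-injective (trans px (sym px′))) }) ∷ y∉ x∉
        ... | inj₂ _ = y∉ x∉
      ... | inj₂ _ = lefts-unique u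

      rights-unique : ∀ {xs} → Unique xs → Unique (rights xs)
      rights-unique [] = []
      rights-unique {x ∷ _} (x∉ ∷ u) with p x in px
      ... | inj₁ _ = rights-unique u
      ... | inj₂ z = z∉ x∉ ∷ rights-unique u
        where
        z∉ : ∀ {ys} → All (x ≢_) ys → All (z ≢_) (rights ys)
        z∉ [] = []
        z∉ {x′ ∷ _} (x≢x′ ∷ x∉) with p x′ in px′
        ... | inj₁ _ = z∉ x∉
        ... | inj₂ _ = (λ { refl → x≢x′ (p-injective (trans px (sym px′))) }) ∷ z∉ x∉

  splitAt-injective : ∀ m {n} → Injective _≡_ _≡_ (splitAt m {n})
  splitAt-injective m {n} {i} {j} e =
    trans (sym (join-splitAt m n i)) (trans (cong (join m n) e) (join-splitAt m n j))

  join-injective : ∀ m n → Injective _≡_ _≡_ (join m n)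
  join-injective m n {u} {u′} e =
    trans (sym (splitAt-join m n u)) (trans (cong (splitAt m) e) (splitAt-join m n u′))

  cast-injective : ∀ {m n} (eq : m ≡ n) → Injective _≡_ _≡_ (cast eq)
  cast-injective eq {i} {j} e =
    trans (sym (cast-involutive (sym eq) eq i))
          (trans (cong (cast (sym eq)) e) (cast-involutive (sym eq) eq j))

  infixr 5 _∥_

  _∥_ : ∀ {m n x y} → (Fin m → Fin x) → (Fin n → Fin y) → Fin (m + n) → Fin (x + y)
  _∥_ {m} {x = x} {y} f g i = join x y (Sum.map f g (splitAt m i))

  ∥-collision : ∀ {m n x y} {f : Fin m → Fin x} {g : Fin n → Fin y} {xs} →
    Collision (f ∥ g) xs →
    Collision f (lefts (splitAt m) xs) ⊎ Collision g (rights (splitAt m) xs)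
  ∥-collision {m} {x = x} {y} {f} {g} (i , j , i∈ , j∈ , i≢j , e)
    with splitAt m i in si | splitAt m j in sj
       | join-injective x y {Sum.map f g (splitAt m i)} {Sum.map f g (splitAt m j)} e
  ... | inj₁ a | inj₁ b | fa≡fb =
    inj₁ (a , b , ∈-lefts _ i∈ si , ∈-lefts _ j∈ sj ,
          (λ a≡b → i≢j (splitAt-injective m (trans si (trans (cong inj₁ a≡b) (sym sj))))) ,
          Sum.inj₁-injective fa≡fb)
  ... | inj₂ a | inj₂ b | ga≡gb =
    inj₂ (a , b , ∈-rights _ i∈ si , ∈-rights _ j∈ sj ,
          (λ a≡b → i≢j (splitAt-injective m (trans si (trans (cong inj₂ a≡b) (sym sj))))) ,
          Sum.inj₂-injective ga≡gb)

  length-Fin0 : (xs : List (Fin 0)) → length xs ≡ 0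
  length-Fin0 [] = refl

  -- Column sets of the shape m + (n + 0), which is what `2 * m` unfolds to.
  module _ {m n : ℕ} where

    firstCopy : List (Fin (m + (n + 0))) → List (Fin m)
    firstCopy = lefts (splitAt m)

    secondCopy : List (Fin (m + (n + 0))) → List (Fin n)
    secondCopy = lefts (splitAt n) ∘ rights (splitAt m)

    length-copies : ∀ xs → length (firstCopy xs) + length (secondCopy xs) ≡ length xs
    length-copies xs = begin
      length (firstCopy xs) + length (secondCopy xs)
        ≡⟨ cong (length (firstCopy xs) +_) (sym (+-identityʳ _)) ⟩
      length (firstCopy xs) + (length (secondCopy xs) + 0)
        ≡⟨ cong (λ ℓ → length (firstCopy xs) + (length (secondCopy xs) + ℓ))
                (sym (length-Fin0 (rights (splitAt n) (rights (splitAt m) xs)))) ⟩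
      length (firstCopy xs) + (length (secondCopy xs) + length (rights (splitAt n) (rights (splitAt m) xs)))
        ≡⟨ cong (length (firstCopy xs) +_) (length-lefts+rights _ (rights (splitAt m) xs)) ⟩
      length (firstCopy xs) + length (rights (splitAt m) xs)
        ≡⟨ length-lefts+rights _ xs ⟩
      length xs ∎
      where open ≡-Reasoning

    copies-unique : ∀ {xs} → Unique xs → Unique (firstCopy xs) × Unique (secondCopy xs)
    copies-unique u =
      lefts-unique _ (splitAt-injective m) u ,
      lefts-unique _ (splitAt-injective n) (rights-unique _ (splitAt-injective m) u)

    copies-collision : ∀ {x y} {f : Fin m → Fin x} {g : Fin n → Fin y} {xs} →
      Collision (f ∥ g ∥ id {A = Fin 0}) xs →
      Collision f (firstCopy xs) ⊎ Collision g (secondCopy xs)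
    copies-collision {f = f} {g} c with ∥-collision {f = f} {g ∥ id} c
    ... | inj₁ cf = inj₁ cf
    ... | inj₂ c′ with ∥-collision {f = g} {id {A = Fin 0}} c′
    ...   | inj₁ cg = inj₂ cg

  data Entry (k : ℕ) : Set where
    fresh : Entry k
    copy : ∀ {v} → (Fin k → Fin v) → Entry k

  alphabet : Entry k → ℕ
  alphabet {k} fresh = k
  alphabet (copy {v} _) = v

  symbols : (e : Entry k) → Fin k → Fin (alphabet e)
  symbols fresh = id
  symbols (copy f) = f

  isCopy : Entry k → Bool
  isCopy fresh = false
  isCopy (copy _) = true

  Hit : Entry k → List (Fin k) → Set
  Hit fresh _ = ⊥
  Hit (copy f) xs = Collision f xs

  collision⇒hit : ∀ (e : Entry k) {xs} → Collision (symbols e) xs → Hit e xs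
  collision⇒hit fresh (_ , _ , _ , _ , i≢j , i≡j) = i≢j i≡j
  collision⇒hit (copy _) c = c

  hit⇒isCopy : ∀ (e : Entry k) {xs} → Hit e xs → T (isCopy e)
  hit⇒isCopy (copy _) _ = _

  select : ∀ {n} {P : Fin n → Set} (choice : Σ (Fin n) P) (i : Fin n) →
    True (proj₁ choice ≟ i) → P i
  select {P = P} (t , x) i t≡i = subst P (toWitness t≡i) x

  module Construction {κ₁ κ₂ κ₃ : ℕ} {v₁ : Fin 3 → ℕ} {v₂ v₃ : Fin 2 → ℕ}
                      (F : HHF 3 κ₁ v₁) (P₂ : HHF 2 κ₂ v₂) (P₃ : HHF 2 κ₃ v₃) where

    K : ℕ
    K = 2 * κ₁ + 2 * κ₂ + κ₃

    size : Fin 5 → ℕ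
    size = κ₁ Vector.∷ κ₁ Vector.∷ κ₂ Vector.∷ κ₂ Vector.∷ κ₃ Vector.∷ Vector.[]

    Layout : Set
    Layout = (G : Fin 5) → Entry (size G)

    alphabets : Layout → ℕ
    alphabets e = (alphabet (e 0F) + (alphabet (e 1F) + 0)) + (alphabet (e 2F) + (alphabet (e 3F) + 0))
                + alphabet (e 4F)

    twoBlocks : ∀ {m n} (a : Entry m) (b : Entry n) →
      Fin (m + (n + 0)) → Fin (alphabet a + (alphabet b + 0))
    twoBlocks a b = symbols a ∥ symbols b ∥ id

    layout : (e : Layout) → Fin K → Fin (alphabets e)
    layout e = (twoBlocks (e 0F) (e 1F) ∥ twoBlocks (e 2F) (e 3F)) ∥ symbols (e 4F)

    blocksA : List (Fin K) → List (Fin (2 * κ₁))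
    blocksA = lefts (splitAt (2 * κ₁)) ∘ lefts (splitAt (2 * κ₁ + 2 * κ₂))

    blocksB : List (Fin K) → List (Fin (2 * κ₂))
    blocksB = rights (splitAt (2 * κ₁)) ∘ lefts (splitAt (2 * κ₁ + 2 * κ₂))

    blockC : List (Fin K) → List (Fin κ₃)
    blockC = rights (splitAt (2 * κ₁ + 2 * κ₂))

    blocksA-unique : ∀ {xs} → Unique xs → Unique (blocksA xs)
    blocksA-unique = lefts-unique _ (splitAt-injective _) ∘ lefts-unique _ (splitAt-injective _)

    blocksB-unique : ∀ {xs} → Unique xs → Unique (blocksB xs)
    blocksB-unique = rights-unique _ (splitAt-injective _) ∘ lefts-unique _ (splitAt-injective _)

    leaf : (G : Fin 5) → List (Fin K) → List (Fin (size G))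
    leaf 0F = firstCopy {κ₁} {κ₁} ∘ blocksA
    leaf 1F = secondCopy {κ₁} {κ₁} ∘ blocksA
    leaf 2F = firstCopy {κ₂} {κ₂} ∘ blocksB
    leaf 3F = secondCopy {κ₂} {κ₂} ∘ blocksB
    leaf 4F = blockC

    leaf-unique : ∀ {xs} → Unique xs → ∀ G → Unique (leaf G xs)
    leaf-unique u 0F = proj₁ (copies-unique {κ₁} {κ₁} (blocksA-unique u))
    leaf-unique u 1F = proj₂ (copies-unique {κ₁} {κ₁} (blocksA-unique u))
    leaf-unique u 2F = proj₁ (copies-unique {κ₂} {κ₂} (blocksB-unique u))
    leaf-unique u 3F = proj₂ (copies-unique {κ₂} {κ₂} (blocksB-unique u))
    leaf-unique u 4F = rights-unique _ (splitAt-injective _) u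

    length-leaves : ∀ xs →
      ((length (leaf 0F xs) + length (leaf 1F xs)) + (length (leaf 2F xs) + length (leaf 3F xs)))
      + length (leaf 4F xs) ≡ length xs
    length-leaves xs = begin
      ((length (leaf 0F xs) + length (leaf 1F xs)) + (length (leaf 2F xs) + length (leaf 3F xs)))
      + length (blockC xs)
        ≡⟨ cong₂ (λ a b → a + b + length (blockC xs))
                 (length-copies {κ₁} {κ₁} (blocksA xs)) (length-copies {κ₂} {κ₂} (blocksB xs)) ⟩
      (length (blocksA xs) + length (blocksB xs)) + length (blockC xs)
        ≡⟨ cong (_+ length (blockC xs)) (length-lefts+rights _ (lefts (splitAt (2 * κ₁ + 2 * κ₂)) xs)) ⟩
      length (lefts (splitAt (2 * κ₁ + 2 * κ₂)) xs) + length (blockC xs)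
        ≡⟨ length-lefts+rights _ xs ⟩
      length xs ∎
      where open ≡-Reasoning

    layout-hit : (e : Layout) {xs : List (Fin K)} →
      Collision (layout e) xs → ∃[ G ] Hit (e G) (leaf G xs)
    layout-hit e c with ∥-collision {f = twoBlocks (e 0F) (e 1F) ∥ twoBlocks (e 2F) (e 3F)} c
    ... | inj₂ c₄ = 4F , collision⇒hit (e 4F) c₄
    ... | inj₁ cAB with ∥-collision {f = twoBlocks (e 0F) (e 1F)} {twoBlocks (e 2F) (e 3F)} cAB
    ...   | inj₁ cA with copies-collision {κ₁} {κ₁} {f = symbols (e 0F)} {symbols (e 1F)} cA
    ...     | inj₁ c₀ = 0F , collision⇒hit (e 0F) c₀
    ...     | inj₂ c₁ = 1F , collision⇒hit (e 1F) c₁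
    layout-hit e c | inj₁ _ | inj₂ cB
      with copies-collision {κ₂} {κ₂} {f = symbols (e 2F)} {symbols (e 3F)} cB
    ...     | inj₁ c₂ = 2F , collision⇒hit (e 2F) c₂
    ...     | inj₂ c₃ = 3F , collision⇒hit (e 3F) c₃

    -- Blocks 0F, …, 4F are A₁, A₂, B₁, B₂, C.
    table : Fin 5 → Layout
    table 0F = λ { 0F → fresh       ; 1F → copy (F 0F) ; 2F → fresh        ; 3F → fresh        ; 4F → copy (P₃ 0F) }
    table 1F = λ { 0F → copy (F 0F) ; 1F → fresh       ; 2F → fresh        ; 3F → fresh        ; 4F → copy (P₃ 1F) }
    table 2F = λ { 0F → fresh       ; 1F → fresh       ; 2F → copy (P₂ 0F) ; 3F → copy (P₂ 1F) ; 4F → fresh }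
    table 3F = λ { 0F → copy (F 2F) ; 1F → copy (F 1F) ; 2F → copy (P₂ 1F) ; 3F → fresh        ; 4F → fresh }
    table 4F = λ { 0F → copy (F 1F) ; 1F → copy (F 2F) ; 2F → fresh        ; 3F → copy (P₂ 0F) ; 4F → fresh }

    W : Fin 5 → ℕ
    W = (κ₁ + 2 * κ₂ + v₁ zero + v₃ zero)
      Vector.∷ (κ₁ + 2 * κ₂ + v₁ zero + v₃ (suc zero))
      Vector.∷ (2 * κ₁ + κ₃ + v₂ zero + v₂ (suc zero))
      Vector.∷ (κ₂ + κ₃ + v₁ (suc zero) + v₁ (suc (suc zero)) + v₂ (suc zero))
      Vector.∷ (κ₂ + κ₃ + v₂ zero + v₁ (suc zero) + v₁ (suc (suc zero)))
      Vector.∷ Vector.[]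

    alphabets-table : ∀ r → alphabets (table r) ≡ W r
    alphabets-table 0F = row₀ κ₁ κ₂ (v₁ 0F) (v₃ 0F)
      where
      row₀ : ∀ a b c d → a + (c + 0) + (b + (b + 0)) + d ≡ a + 2 * b + c + d
      row₀ = solve-∀
    alphabets-table 1F = row₁ κ₁ κ₂ (v₁ 0F) (v₃ 1F)
      where
      row₁ : ∀ a b c d → c + (a + 0) + (b + (b + 0)) + d ≡ a + 2 * b + c + d
      row₁ = solve-∀
    alphabets-table 2F = row₂ κ₁ κ₃ (v₂ 0F) (v₂ 1F)
      where
      row₂ : ∀ a b c d → a + (a + 0) + (c + (d + 0)) + b ≡ 2 * a + b + c + d
      row₂ = solve-∀
    alphabets-table 3F = row₃ κ₂ κ₃ (v₁ 1F) (v₁ 2F) (v₂ 1F)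
      where
      row₃ : ∀ a b c d e → d + (c + 0) + (e + (a + 0)) + b ≡ a + b + c + d + e
      row₃ = solve-∀
    alphabets-table 4F = row₄ κ₂ κ₃ (v₂ 0F) (v₁ 1F) (v₁ 2F)
      where
      row₄ : ∀ a b c d e → d + (e + 0) + (a + (c + 0)) + b ≡ a + b + c + d + e
      row₄ = solve-∀

    array : HHF 5 K W
    array r = cast (alphabets-table r) ∘ layout (table r)

    array-collision : ∀ r {xs} → Collision (array r) xs → Collision (layout (table r)) xs
    array-collision r = collision-∘ (cast-injective (alphabets-table r))

    chose : Fin 5 → Fin 5 → Bool
    chose t G = isYes (t ≟ G)

    -- Row r collides in block t r; block G is charged the columns needed by the rows
    -- colliding in it, which are listed in the order of the component rows they copy.
    forced : (t₀ t₁ t₂ t₃ t₄ : Fin 5) → ℕ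
    forced t₀ t₁ t₂ t₃ t₄ =
        (columnsNeeded (bit (chose t₁ 0F) + bit (chose t₄ 0F) + bit (chose t₃ 0F))
         + columnsNeeded (bit (chose t₀ 1F) + bit (chose t₃ 1F) + bit (chose t₄ 1F)))
      + (columnsNeeded (bit (chose t₂ 2F) + bit (chose t₃ 2F))
         + columnsNeeded (bit (chose t₄ 3F) + bit (chose t₂ 3F)))
      + columnsNeeded (bit (chose t₀ 4F) + bit (chose t₁ 4F))

    -- forced counts every row once and every block met by some row once more; no two
    -- blocks meet all five rows in copied entries, so at least three blocks are met.
    -- Checked over all 5⁵ choices.
    8≤forced : ∀ t₀ t₁ t₂ t₃ t₄ →
      T (isCopy (table 0F t₀)) → T (isCopy (table 1F t₁)) → T (isCopy (table 2F t₂)) →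
      T (isCopy (table 3F t₃)) → T (isCopy (table 4F t₄)) → 8 ≤ forced t₀ t₁ t₂ t₃ t₄
    8≤forced = toWitness {a? = all? λ t₀ → all? λ t₁ → all? λ t₂ → all? λ t₃ → all? λ t₄ →
      T? (isCopy (table 0F t₀)) →-dec T? (isCopy (table 1F t₁)) →-dec T? (isCopy (table 2F t₂)) →-dec
      T? (isCopy (table 3F t₃)) →-dec T? (isCopy (table 4F t₄)) →-dec 8 ≤? forced t₀ t₁ t₂ t₃ t₄} _

    module _ (fractal : IsFractalPHHF 3 κ₁ v₁ F)
             (perfect₂ : IsPHHF 2 κ₂ v₂ 2 P₂) (perfect₃ : IsPHHF 2 κ₃ v₃ 2 P₃) where

      Covered : List (Fin K) → Fin 5 → Set
      Covered xs r = ∃[ G ] Hit (table r G) (leaf G xs)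

      no-covering : ∀ {xs} → Unique xs → length xs ≡ 7 → ¬ (∀ r → Covered xs r)
      no-covering {xs} u length≡7 cover = <-irrefl refl (begin-strict
        7                                         <⟨ 8≤forced t₀ t₁ t₂ t₃ t₄ (copied 0F) (copied 1F)
                                                                (copied 2F) (copied 3F) (copied 4F) ⟩
        forced t₀ t₁ t₂ t₃ t₄                     ≤⟨ +-mono-≤ (+-mono-≤ (+-mono-≤ A₁ A₂) (+-mono-≤ B₁ B₂)) C ⟩
        ((ℓ 0F + ℓ 1F) + (ℓ 2F + ℓ 3F)) + ℓ 4F    ≡⟨ length-leaves xs ⟩
        length xs                                 ≡⟨ length≡7 ⟩
        7                                         ∎)
        where
        open ≤-Reasoning
        ℓ : Fin 5 → ℕ
        ℓ G = length (leaf G xs)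
        tag : Fin 5 → Fin 5
        tag r = proj₁ (cover r)
        t₀ t₁ t₂ t₃ t₄ : Fin 5
        t₀ = tag 0F; t₁ = tag 1F; t₂ = tag 2F; t₃ = tag 3F; t₄ = tag 4F
        copied : ∀ r → T (isCopy (table r (tag r)))
        copied r = hit⇒isCopy (table r (tag r)) (proj₂ (cover r))
        A₁ : columnsNeeded (bit (chose t₁ 0F) + bit (chose t₄ 0F) + bit (chose t₃ 0F)) ≤ ℓ 0F
        A₁ = fractal₃-bound F fractal (leaf-unique u 0F) (chose t₁ 0F) (chose t₄ 0F) (chose t₃ 0F)
               (select (cover 1F) 0F) (select (cover 4F) 0F) (select (cover 3F) 0F)
        A₂ : columnsNeeded (bit (chose t₀ 1F) + bit (chose t₃ 1F) + bit (chose t₄ 1F)) ≤ ℓ 1F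
        A₂ = fractal₃-bound F fractal (leaf-unique u 1F) (chose t₀ 1F) (chose t₃ 1F) (chose t₄ 1F)
               (select (cover 0F) 1F) (select (cover 3F) 1F) (select (cover 4F) 1F)
        B₁ : columnsNeeded (bit (chose t₂ 2F) + bit (chose t₃ 2F)) ≤ ℓ 2F
        B₁ = perfect₂-bound P₂ perfect₂ (leaf-unique u 2F) (chose t₂ 2F) (chose t₃ 2F)
               (select (cover 2F) 2F) (select (cover 3F) 2F)
        B₂ : columnsNeeded (bit (chose t₄ 3F) + bit (chose t₂ 3F)) ≤ ℓ 3F
        B₂ = perfect₂-bound P₂ perfect₂ (leaf-unique u 3F) (chose t₄ 3F) (chose t₂ 3F)
               (select (cover 4F) 3F) (select (cover 2F) 3F)
        C : columnsNeeded (bit (chose t₀ 4F) + bit (chose t₁ 4F)) ≤ ℓ 4F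
        C = perfect₂-bound P₃ perfect₃ (leaf-unique u 4F) (chose t₀ 4F) (chose t₁ 4F)
              (select (cover 0F) 4F) (select (cover 1F) 4F)

      isPHHF : IsPHHF 5 K W 7 array
      isPHHF s s-injective c = separating (all? collision?ₛ)
        where
        Collisionₛ : Fin 5 → Set
        Collisionₛ r = Collision (array r) (tabulate s)
        collision?ₛ : ∀ r → Dec (Collisionₛ r)
        collision?ₛ r = collision? (array r) (tabulate s)
        separating : Dec (∀ r → Collisionₛ r) → ∃[ r ] Separates array r s c
        separating (yes collide) =
          ⊥-elim (no-covering {tabulate s} (tabulate⁺ s-injective) (length-tabulate s) λ r →
                    layout-hit (table r) {tabulate s} (array-collision r {tabulate s} (collide r)))
        separating (no ¬collide) =
          Product.map₂ (λ {r} → collision-free⇒separates array {r} {s} {c = c} s-injective)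
                       (¬∀⟶∃¬ 5 Collisionₛ collision?ₛ ¬collide)

open import Data.Product using (_,_)
open import Data.Vec.Functional using (_∷_; [])
open Construction using (array; isPHHF)

lemma24 : (κ₁ κ₂ κ₃ : ℕ) (v₁ : Fin 3 → ℕ) (v₂ v₃ : Fin 2 → ℕ) →
    PHHF 2 κ₂ v₂ 2 → PHHF 2 κ₃ v₃ 2 → FractalPHHF 3 κ₁ v₁ →
    PHHF 5 (2 * κ₁ + 2 * κ₂ + κ₃)
      ( (κ₁ + 2 * κ₂ + v₁ zero + v₃ zero)
      ∷ (κ₁ + 2 * κ₂ + v₁ zero + v₃ (suc zero))
      ∷ (2 * κ₁ + κ₃ + v₂ zero + v₂ (suc zero))
      ∷ (κ₂ + κ₃ + v₁ (suc zero) + v₁ (suc (suc zero)) + v₂ (suc zero))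
      ∷ (κ₂ + κ₃ + v₂ zero + v₁ (suc zero) + v₁ (suc (suc zero)))
      ∷ [])
      7
lemma24 κ₁ κ₂ κ₃ v₁ v₂ v₃ (P₂ , perfect₂) (P₃ , perfect₃) (F , fractal) =
  array F P₂ P₃ , isPHHF F P₂ P₃ fractal perfect₂ perfect₃
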